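{- Let $E$ be a finite set and let $\mathcal{W}\subseteq\{+,-,0\}^E$ satisfy (A1), (A2), (A3) below. Let $N_1,N_2\in\mathcal{P}(\mathcal{W})$ with $N_1\neq N_2$ and $\underline{N_1}=\underline{N_2}$. Let $U,U'\in\mathrm{asym}(\mathcal{W})$ with $\underline{U}=\underline{U'}$, $I(U,-U')\cap\mathcal{W}=I(-U,U')\cap\mathcal{W}=\emptyset$ and $N_1=U+(-U')$. Let $V=(-N_2)\circ U$. Then the pair $(U,V)$ does not witness $U+(-V)\in\mathcal{P}(\mathcal{W})$; that is, it is not the case that $U,V\in\mathrm{asym}(\mathcal{W})$, $\underline{U}=\underline{V}$ and $I(U,-V)\cap\mathcal{W}=I(-U,V)\cap\mathcal{W}=\emptyset$. Axioms: (A1) if $X,Y\in\mathcal{W}$ then $X\circ Y\in\mathcal{W}$ and $X\circ(-Y)\in\mathcal{W}$; (A2) if $X,Y\in\mathcal{W}$ with $\underline{X}=\underline{Y}$, then $I_e(X,Y)\cap\mathcal{W}\neq\emptyset$ for all $e\in S(X,Y)$; (A3) $P\circ W\in\mathcal{W}$ for all $P\in\mathcal{P}(\mathcal{W})$, $W\in\mathcal{W}$.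
   Context: A sign vector on a finite set $E$ is $X\in\{+,-,0\}^E$ with support $\underline{X}=\{e: X_e\neq0\}$; $-X$ swaps $+$ and $-$; composition $(X\circ Y)_e=X_e$ if $X_e\neq0$, else $Y_e$; $S(X,Y)=\{e: X_e,Y_e\neq0, X_e\neq Y_e\}$; sum $(X+Y)_e=0$ if $e\in S(X,Y)$ and $(X\circ Y)_e$ otherwise. For $X\neq Y$ with $\underline{X}=\underline{Y}$ and $e\in S(X,Y)$: $I_e(X,Y)=\{V : \underline{V}\subseteq\underline{X}-\{e\},\ V_f=X_f \text{ for all } f\notin S(X,Y)\}$, $I(X,Y)=\bigcup_{e\in S(X,Y)}I_e(X,Y)$. $\mathrm{sym}(\mathcal{W})=\{V: V,-V\in\mathcal{W}\}$, $\mathrm{asym}(\mathcal{W})=\mathcal{W}-\mathrm{sym}(\mathcal{W})$, $\mathcal{P}(\mathcal{W})=\{X+(-Y): X,Y\in\mathrm{asym}(\mathcal{W}),\ \underline{X}=\underline{Y},\ I(X,-Y)\cap\mathcal{W}=I(-X,Y)\cap\mathcal{W}=\emptyset\}$. -}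

module Defs where

open import Data.Nat using (ℕ)
open import Data.Fin using (Fin)
open import Data.Vec using (Vec; map; zipWith; lookup)
open import Data.Product using (_×_; ∃; Σ-syntax)
open import Relation.Binary.PropositionalEquality using (_≡_; _≢_)
open import Relation.Nullary using (¬_)

data Sign : Set where
  ⊕ ⊖ ∅ : Sign

SignVec : ℕ → Set
SignVec n = Vec Sign n

negS : Sign → Sign
negS ⊕ = ⊖
negS ⊖ = ⊕
negS ∅ = ∅

compS : Sign → Sign → Sign
compS ∅ y = y
compS x y = x

sumS : Sign → Sign → Sign
sumS ⊕ ⊖ = ∅
sumS ⊖ ⊕ = ∅
sumS x y = compS x y

module _ {n : ℕ} where

  neg : SignVec n → SignVec n
  neg = map negS

  _∘ₛ_ : SignVec n → SignVec n → SignVec n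
  _∘ₛ_ = zipWith compS

  _+ₛ_ : SignVec n → SignVec n → SignVec n
  _+ₛ_ = zipWith sumS

  SameSupp : SignVec n → SignVec n → Set
  SameSupp X Y = ∀ e → (lookup X e ≡ ∅ → lookup Y e ≡ ∅) × (lookup Y e ≡ ∅ → lookup X e ≡ ∅)

  InS : SignVec n → SignVec n → Fin n → Set
  InS X Y e = (lookup X e ≢ ∅) × (lookup Y e ≢ ∅) × (lookup X e ≢ lookup Y e)

  InIe : SignVec n → SignVec n → Fin n → SignVec n → Set
  InIe X Y e V =
    (∀ f → lookup V f ≢ ∅ → (lookup X f ≢ ∅) × (f ≢ e)) ×
    (∀ f → ¬ InS X Y f → lookup V f ≡ lookup X f)

  InI : SignVec n → SignVec n → SignVec n → Set
  InI X Y V = ∃ λ e → InS X Y e × InIe X Y e V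

  IDisjoint : (SignVec n → Set) → SignVec n → SignVec n → Set
  IDisjoint W X Y = ∀ V → InI X Y V → ¬ W V

  Sym : (SignVec n → Set) → SignVec n → Set
  Sym W V = W V × W (neg V)

  Asym : (SignVec n → Set) → SignVec n → Set
  Asym W V = W V × ¬ Sym W V

  Witness : (SignVec n → Set) → SignVec n → SignVec n → Set
  Witness W X Y =
    Asym W X × Asym W Y × SameSupp X Y ×
    IDisjoint W X (neg Y) × IDisjoint W (neg X) Y

  InP : (SignVec n → Set) → SignVec n → Set
  InP W P = ∃ λ X → ∃ λ Y → Witness W X Y × P ≡ X +ₛ neg Y

  A1 : (SignVec n → Set) → Set
  A1 W = ∀ X Y → W X → W Y → W (X ∘ₛ Y) × W (X ∘ₛ neg Y)

  A2 : (SignVec n → Set) → Set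
  A2 W = ∀ X Y → W X → W Y → SameSupp X Y →
         ∀ e → InS X Y e → ∃ λ V → InIe X Y e V × W V

  A3 : (SignVec n → Set) → Set
  A3 W = ∀ P V → InP W P → W V → W (P ∘ₛ V)

-- Suppose (U, V) were a witness. By (A3), N₂ ∘ U ∈ 𝒲, and it has the support of U
-- because supp N₂ = supp N₁ ⊆ supp U. At a coordinate e where N₁ and N₂ differ both are
-- nonzero, N₁ agrees with U there, so e ∈ S(U, N₂ ∘ U) and (A2) yields some
-- V′ ∈ I_e(U, N₂ ∘ U) ∩ 𝒲. Since -V = N₂ ∘ (-U), we have S(U, N₂ ∘ U) ⊆ S(U, -V), hence
-- V′ ∈ I(U, -V) ∩ 𝒲, contradicting the witness condition.
module Submission where

open import Defs
open import Data.Nat using (ℕ)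
open import Data.Fin using (Fin)
open import Data.Fin.Properties using (¬∀⟶∃¬)
open import Data.Vec using (lookup)
open import Data.Vec.Properties using (lookup-map; lookup-zipWith)
open import Data.Vec.Relation.Binary.Pointwise.Extensional using (ext; Pointwise-≡⇒≡)
open import Data.Product using (_×_; _,_; proj₁; proj₂; ∃)
open import Data.Empty using (⊥-elim)
open import Function using (_∘_)
open import Relation.Binary.Definitions using (DecidableEquality)
open import Relation.Binary.PropositionalEquality using (_≡_; _≢_; refl; sym; trans; subst)
open import Relation.Nullary using (¬_; yes; no)

_≟ₛ_ : DecidableEquality Sign
⊕ ≟ₛ ⊕ = yes refl
⊖ ≟ₛ ⊖ = yes refl
∅ ≟ₛ ∅ = yes refl
⊕ ≟ₛ ⊖ = no λ ()
⊕ ≟ₛ ∅ = no λ ()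
⊖ ≟ₛ ⊕ = no λ ()
⊖ ≟ₛ ∅ = no λ ()
∅ ≟ₛ ⊕ = no λ ()
∅ ≟ₛ ⊖ = no λ ()

InSₛ : Sign → Sign → Set
InSₛ x y = (x ≢ ∅) × (y ≢ ∅) × (x ≢ y)

sumS-neg-∅ : ∀ {u u′} → (u ≡ ∅ → u′ ≡ ∅) → u ≡ ∅ → sumS u (negS u′) ≡ ∅
sumS-neg-∅ u∅⇒u′∅ refl with u∅⇒u′∅ refl
... | refl = refl

sumS-neg-≢∅ : ∀ u {u′} → (u ≡ ∅ → u′ ≡ ∅) → sumS u (negS u′) ≢ ∅ → sumS u (negS u′) ≡ u
sumS-neg-≢∅ ⊕ {⊕} _ s≢∅ = ⊥-elim (s≢∅ refl)
sumS-neg-≢∅ ⊕ {⊖} _ _ = refl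
sumS-neg-≢∅ ⊕ {∅} _ _ = refl
sumS-neg-≢∅ ⊖ {⊕} _ _ = refl
sumS-neg-≢∅ ⊖ {⊖} _ s≢∅ = ⊥-elim (s≢∅ refl)
sumS-neg-≢∅ ⊖ {∅} _ _ = refl
sumS-neg-≢∅ ∅ u∅⇒u′∅ s≢∅ = ⊥-elim (s≢∅ (sumS-neg-∅ u∅⇒u′∅ refl))

compS-∅ : ∀ a {u} → (u ≡ ∅ → a ≡ ∅) → u ≡ ∅ → compS a u ≡ ∅
compS-∅ a u∅⇒a∅ refl with u∅⇒a∅ refl
... | refl = refl

compS-∅ʳ : ∀ a {u} → compS a u ≡ ∅ → u ≡ ∅
compS-∅ʳ ∅ c≡∅ = c≡∅

InSₛ-compS : ∀ a {u} → a ≢ ∅ → InSₛ u a → InSₛ u (compS a u)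
InSₛ-compS ⊕ _ s = s
InSₛ-compS ⊖ _ s = s
InSₛ-compS ∅ a≢∅ _ = ⊥-elim (a≢∅ refl)

-- Only coordinates where a is nonzero can lie in S(u, a ∘ u), and there a ∘ u = a ∘ (-u).
InSₛ-compS-neg : ∀ a {u} → InSₛ u (compS a u) → InSₛ u (negS (compS (negS a) u))
InSₛ-compS-neg ⊕ s = s
InSₛ-compS-neg ⊖ s = s
InSₛ-compS-neg ∅ (_ , _ , u≢u) = ⊥-elim (u≢u refl)

module _ {n : ℕ} where

  Supp⊆ : SignVec n → SignVec n → Set
  Supp⊆ X Y = ∀ f → lookup Y f ≡ ∅ → lookup X f ≡ ∅

  lookup-≢ : (X Y : SignVec n) → X ≢ Y → ∃ λ e → lookup X e ≢ lookup Y e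
  lookup-≢ X Y X≢Y =
    ¬∀⟶∃¬ n _ (λ e → lookup X e ≟ₛ lookup Y e) (X≢Y ∘ Pointwise-≡⇒≡ ∘ ext)

  lookup-+ₛ-neg : (X Y : SignVec n) (f : Fin n) →
                  lookup (X +ₛ neg Y) f ≡ sumS (lookup X f) (negS (lookup Y f))
  lookup-+ₛ-neg X Y f rewrite lookup-zipWith sumS f X (neg Y) | lookup-map f negS Y = refl

  lookup-∘ₛ : (X Y : SignVec n) (f : Fin n) → lookup (X ∘ₛ Y) f ≡ compS (lookup X f) (lookup Y f)
  lookup-∘ₛ X Y f = lookup-zipWith compS f X Y

  lookup-neg-neg-∘ₛ : (X Y : SignVec n) (f : Fin n) →
                      lookup (neg (neg X ∘ₛ Y)) f ≡ negS (compS (negS (lookup X f)) (lookup Y f))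
  lookup-neg-neg-∘ₛ X Y f
    rewrite lookup-map f negS (neg X ∘ₛ Y) | lookup-zipWith compS f (neg X) Y | lookup-map f negS X = refl

  SameSupp⇒Supp⊆ : (X Y : SignVec n) → SameSupp X Y → Supp⊆ Y X
  SameSupp⇒Supp⊆ X Y X~Y f = proj₁ (X~Y f)

  SameSupp-≢⇒≢∅ : (X Y : SignVec n) → SameSupp X Y → ∀ e → lookup X e ≢ lookup Y e →
                  lookup X e ≢ ∅ × lookup Y e ≢ ∅
  SameSupp-≢⇒≢∅ X Y X~Y e Xe≢Ye =
    (λ Xe≡∅ → Xe≢Ye (trans Xe≡∅ (sym (proj₁ (X~Y e) Xe≡∅)))) ,
    (λ Ye≡∅ → Xe≢Ye (trans (proj₂ (X~Y e) Ye≡∅) (sym Ye≡∅)))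

  Supp⊆-+ₛ-neg : (X Y : SignVec n) → Supp⊆ Y X → Supp⊆ (X +ₛ neg Y) X
  Supp⊆-+ₛ-neg X Y Y⊆X f Xf≡∅ = trans (lookup-+ₛ-neg X Y f) (sumS-neg-∅ (Y⊆X f) Xf≡∅)

  lookup-+ₛ-neg-≢∅ : (X Y : SignVec n) → Supp⊆ Y X → ∀ f → lookup (X +ₛ neg Y) f ≢ ∅ →
                     lookup (X +ₛ neg Y) f ≡ lookup X f
  lookup-+ₛ-neg-≢∅ X Y Y⊆X f s≢∅ =
    trans (lookup-+ₛ-neg X Y f)
          (sumS-neg-≢∅ (lookup X f) (Y⊆X f) (s≢∅ ∘ trans (lookup-+ₛ-neg X Y f)))

  SameSupp-∘ₛ : (X Y : SignVec n) → Supp⊆ X Y → SameSupp Y (X ∘ₛ Y)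
  SameSupp-∘ₛ X Y X⊆Y f =
    (λ Yf≡∅ → trans (lookup-∘ₛ X Y f) (compS-∅ (lookup X f) (X⊆Y f) Yf≡∅)) ,
    (λ XYf≡∅ → compS-∅ʳ (lookup X f) (trans (sym (lookup-∘ₛ X Y f)) XYf≡∅))

  InS-∘ₛ : (X Y : SignVec n) (e : Fin n) → lookup X e ≢ ∅ → InSₛ (lookup Y e) (lookup X e) →
           InS Y (X ∘ₛ Y) e
  InS-∘ₛ X Y e Xe≢∅ s =
    subst (InSₛ (lookup Y e)) (sym (lookup-∘ₛ X Y e)) (InSₛ-compS (lookup X e) Xe≢∅ s)

  InS-∘ₛ⇒InS-neg-neg-∘ₛ : (X Y : SignVec n) (f : Fin n) →
                           InS Y (X ∘ₛ Y) f → InS Y (neg (neg X ∘ₛ Y)) f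
  InS-∘ₛ⇒InS-neg-neg-∘ₛ X Y f s =
    subst (InSₛ (lookup Y f)) (sym (lookup-neg-neg-∘ₛ X Y f))
          (InSₛ-compS-neg (lookup X f) (subst (InSₛ (lookup Y f)) (lookup-∘ₛ X Y f) s))

  InIe-mono : (X Y Y′ : SignVec n) → (∀ f → InS X Y f → InS X Y′ f) →
              ∀ e V → InIe X Y e V → InIe X Y′ e V
  InIe-mono X Y Y′ S⊆S′ e V (supp , agree) = supp , λ f f∉S′ → agree f (f∉S′ ∘ S⊆S′ f)

  A2⇒I∩W-nonempty : (W : SignVec n → Set) → A2 W → (X U : SignVec n) → W U → W (X ∘ₛ U) →
                       Supp⊆ X U → ∀ e → InS U (X ∘ₛ U) e →
                       ∃ λ V′ → InI U (neg (neg X ∘ₛ U)) V′ × W V′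
  A2⇒I∩W-nonempty W a2 X U U∈W X∘U∈W X⊆U e e∈S with a2 U (X ∘ₛ U) U∈W X∘U∈W (SameSupp-∘ₛ X U X⊆U) e e∈S
  ... | V′ , V′∈Ie , V′∈W =
    V′ , (e , InS-∘ₛ⇒InS-neg-neg-∘ₛ X U e e∈S ,
          InIe-mono U (X ∘ₛ U) (neg (neg X ∘ₛ U)) (InS-∘ₛ⇒InS-neg-neg-∘ₛ X U) e V′ V′∈Ie) ,
    V′∈W

  Supp⊆-+ₛ-neg-SameSupp : (X Y N : SignVec n) → SameSupp X Y → SameSupp (X +ₛ neg Y) N → Supp⊆ N X
  Supp⊆-+ₛ-neg-SameSupp X Y N X~Y X-Y~N f =
    SameSupp⇒Supp⊆ (X +ₛ neg Y) N X-Y~N f ∘ Supp⊆-+ₛ-neg X Y (SameSupp⇒Supp⊆ X Y X~Y) f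

  -- Where X - Y and N differ both are nonzero, and X - Y agrees with X there.
  ≢-SameSupp⇒InS-∘ₛ : (X Y N : SignVec n) → SameSupp X Y → SameSupp (X +ₛ neg Y) N →
                       X +ₛ neg Y ≢ N → ∃ λ e → InS X (N ∘ₛ X) e
  ≢-SameSupp⇒InS-∘ₛ X Y N X~Y X-Y~N X-Y≢N =
    e , InS-∘ₛ N X e Ne≢∅ (X-Ye≢∅ ∘ trans X-Ye≡Xe , Ne≢∅ , X-Ye≢Ne ∘ trans X-Ye≡Xe)
    where
    differs : ∃ λ e → lookup (X +ₛ neg Y) e ≢ lookup N e
    differs = lookup-≢ (X +ₛ neg Y) N X-Y≢N

    e : Fin n
    e = proj₁ differs

    X-Ye≢Ne : lookup (X +ₛ neg Y) e ≢ lookup N e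
    X-Ye≢Ne = proj₂ differs

    X-Ye≢∅ : lookup (X +ₛ neg Y) e ≢ ∅
    X-Ye≢∅ = proj₁ (SameSupp-≢⇒≢∅ (X +ₛ neg Y) N X-Y~N e X-Ye≢Ne)

    Ne≢∅ : lookup N e ≢ ∅
    Ne≢∅ = proj₂ (SameSupp-≢⇒≢∅ (X +ₛ neg Y) N X-Y~N e X-Ye≢Ne)

    X-Ye≡Xe : lookup (X +ₛ neg Y) e ≡ lookup X e
    X-Ye≡Xe = lookup-+ₛ-neg-≢∅ X Y (SameSupp⇒Supp⊆ X Y X~Y) e X-Ye≢∅

lemma4p1 : (n : ℕ) (W : SignVec n → Set) →
    A1 W → A2 W → A3 W →
    (N₁ N₂ : SignVec n) → InP W N₁ → InP W N₂ → N₁ ≢ N₂ → SameSupp N₁ N₂ →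
    (U U′ : SignVec n) → Witness W U U′ → N₁ ≡ U +ₛ neg U′ →
    ¬ Witness W U (neg N₂ ∘ₛ U)
lemma4p1 n W _ a2 a3 N₁ N₂ _ N₂∈P N₁≢N₂ N₁~N₂ U U′ ((U∈W , _) , _ , U~U′ , _) refl
         (_ , _ , _ , I[U,-V]∩W≡∅ , _)
  with ≢-SameSupp⇒InS-∘ₛ U U′ N₂ U~U′ N₁~N₂ N₁≢N₂
... | e , e∈S[U,N₂∘U]
  with A2⇒I∩W-nonempty W a2 N₂ U U∈W (a3 N₂ U N₂∈P U∈W)
         (Supp⊆-+ₛ-neg-SameSupp U U′ N₂ U~U′ N₁~N₂) e e∈S[U,N₂∘U]
... | V′ , V′∈I[U,-V] , V′∈W = I[U,-V]∩W≡∅ V′ V′∈I[U,-V] V′∈W
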